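{- Let $F_i$ denote the Fibonacci numbers ($F_1=F_2=1$, $F_i=F_{i-1}+F_{i-2}$ for $i\ge 3$). For an integer $n$ and $k\ge 1$, a representation of $n$ of length $k$ is a sequence $(a_k,a_{k-1},\dots,a_1)\in\{ -1,0,1\}^k$ with $\sum_{i=1}^k a_iF_i=n$, and $B(n;k)$ is the number of such representations. Say such a representation starts with $(b_1,\dots,b_r)$ (where $r\le k$) if $a_{k-i+1}=b_i$ for $1\le i\le r$. Let $f(n;k)$ be the number of representations of $n$ of length $k$ starting with $(1,0)$, $(1,1)$, $(-1,0)$, $(-1,-1)$, $(1,-1,1)$, or $(-1,1,-1)$. Then for every integer $n$, \[ B(n;k+1)=B(n;k)+B(n;k-1)+B(n;k-2)+f(n;k+1)\qquad\text{for all } k\ge 3. \] Moreover, there exists a function $f$ on the integers such that for every fixed integer $n$, $f(n;k)=f(n)$ for all sufficiently large $k$ (where how large may depend on $n$).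
   Context: The digit $-1$ is sometimes written $T$. The length of a representation is $k$ even if its leading digit $a_k$ is $0$. Positions $F_1$ and $F_2$ are treated as distinct, so both may be used in one representation. -}

module Defs where

open import Data.Nat as ℕ using (ℕ; zero; suc)
open import Data.Integer as ℤ using (ℤ; +_; -[1+_]; _*_; _+_)
open import Data.List using (List; []; _∷_; length; filter; map; concatMap; take)
open import Data.Bool.ListAction using (any)
open import Data.List.Properties using (≡-dec)
open import Data.Bool using (Bool; true; false; _∨_)
open import Relation.Nullary.Decidable using (⌊_⌋)
open import Relation.Binary.PropositionalEquality using (_≡_)

F : ℕ → ℕ
F zero = 0
F (suc zero) = 1
F (suc (suc n)) = F (suc n) ℕ.+ F n

digits : List ℤ
digits = -[1+ 0 ] ∷ + 0 ∷ + 1 ∷ []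

-- All sequences (a_k, a_{k-1}, ..., a_1) ∈ {-1,0,1}^k, written as lists
-- whose head is a_k (the leading digit) and whose last element is a_1.
seqs : ℕ → List (List ℤ)
seqs zero = [] ∷ []
seqs (suc k) = concatMap (λ d → map (d ∷_) (seqs k)) digits

value : List ℤ → ℤ
value [] = + 0
value (a ∷ as) = a * + F (suc (length as)) + value as

B : ℤ → ℕ → ℕ
B n k = length (filter (λ v → value v ℤ.≟ n) (seqs k))

startsWith : List ℤ → List ℤ → Bool
startsWith b v = ⌊ ≡-dec ℤ._≟_ (take (length b) v) b ⌋

prefixes : List (List ℤ)
prefixes =
  (+ 1 ∷ + 0 ∷ []) ∷ (+ 1 ∷ + 1 ∷ []) ∷
  (-[1+ 0 ] ∷ + 0 ∷ []) ∷ (-[1+ 0 ] ∷ -[1+ 0 ] ∷ []) ∷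
  (+ 1 ∷ -[1+ 0 ] ∷ + 1 ∷ []) ∷ (-[1+ 0 ] ∷ + 1 ∷ -[1+ 0 ] ∷ []) ∷ []

startsSpecial : List ℤ → Bool
startsSpecial v = any (λ b → startsWith b v) prefixes

f : ℤ → ℕ → ℕ
f n k = length (filter (λ v → value v ℤ.≟ n) (filter (λ v → startsSpecial v Data.Bool.≟ true) (seqs k)))

-- Sorting representations by their leading digit gives
-- B(n;k+1) = B(n+F_{k+1};k) + B(n;k) + B(n-F_{k+1};k), and negating every digit gives
-- B(-n;k) = B(n;k).  Unfolding the summand B(n+F_{k+1};k) twice more sorts its
-- representations by their first two or three digits: three of the resulting terms count
-- exactly the representations of length k+1 starting with (-1,-1), (-1,0), (-1,1,-1), and
-- the others, together with their mirror images from B(n-F_{k+1};k), reassemble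
-- B(n;k-1) + B(n;k-2).
--
-- Since k digits only represent |x| < F_{k+2}, once F_{k-4} ≥ |n| the counts for the
-- prefixes (∓1,∓1) and (∓1,±1,∓1) vanish while the count for (∓1,0) stops changing with k,
-- so f(n;k) is eventually constant.

module Submission where

open import Defs
open import Data.Nat using (ℕ; _+_; _≤_; _∸_; suc)
open import Data.Integer using (ℤ)
open import Data.Product using (_×_; ∃)
open import Relation.Binary.PropositionalEquality using (_≡_)

open import Data.Bool as Bool using (Bool; true; false; if_then_else_; _∧_)
open import Data.Integer.Base using (+_; -[1+_]; +0; +[1+_]; -_; _-_; -1ℤ; 0ℤ; 1ℤ)
import Data.Integer.Base as ℤ
import Data.Integer.Properties as ℤ
open import Data.Integer.Tactic.RingSolver using (solve-∀)
open import Data.List using (List; []; _∷_; _++_; map; filter; length)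
open import Data.List.Properties using (length-++; ++-identityʳ)
open import Data.List.Relation.Unary.All as All using (All; []; _∷_)
open import Data.List.Relation.Unary.All.Properties using (concat⁺; map⁺)
open import Data.Nat.Base using (z≤n; s≤s; _≤′_; ≤′-refl; ≤′-step)
import Data.Nat.Properties as ℕ
open import Algebra.Properties.CommutativeSemigroup ℕ.+-commutativeSemigroup using (xy∙z≈zy∙x)
import Data.Nat.Tactic.RingSolver as ℕ-Solver
open import Data.Product using (_,_)
open import Function.Bundles using (mk⇔)
open import Relation.Binary.PropositionalEquality using (refl; sym; trans; cong; cong₂; subst)
open import Relation.Nullary using (does)
open import Relation.Nullary.Decidable using (does-⇔)
open import Relation.Unary using (Decidable)

open Relation.Binary.PropositionalEquality.≡-Reasoning

indicator : Bool → ℕ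
indicator b = if b then 1 else 0

count : ∀ {A : Set} → (A → Bool) → List A → ℕ
count p [] = 0
count p (x ∷ xs) = indicator (p x) + count p xs

module _ {A : Set} (p : A → Bool) where

  count-++ : ∀ xs ys → count p (xs ++ ys) ≡ count p xs + count p ys
  count-++ [] ys = refl
  count-++ (x ∷ xs) ys = trans (cong (λ n → indicator (p x) + n) (count-++ xs ys))
                               (sym (ℕ.+-assoc (indicator (p x)) (count p xs) _))

  count-map : ∀ {B : Set} (g : B → A) xs → count p (map g xs) ≡ count (λ x → p (g x)) xs
  count-map g [] = refl
  count-map g (x ∷ xs) = cong (λ n → indicator (p (g x)) + n) (count-map g xs)

  count-cong : ∀ {q : A → Bool} {xs} → All (λ x → p x ≡ q x) xs → count p xs ≡ count q xs
  count-cong [] = refl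
  count-cong (px≡qx ∷ eqs) = cong₂ _+_ (cong indicator px≡qx) (count-cong eqs)

  count-filter : ∀ {P : A → Set} (P? : Decidable P) xs →
                 count p (filter P? xs) ≡ count (λ x → does (P? x) ∧ p x) xs
  count-filter P? [] = refl
  count-filter P? (x ∷ xs) with does (P? x)
  ... | true = cong (λ n → indicator (p x) + n) (count-filter P? xs)
  ... | false = count-filter P? xs

count-false : ∀ {A : Set} (xs : List A) → count (λ _ → false) xs ≡ 0
count-false [] = refl
count-false (x ∷ xs) = count-false xs

length-filter≡count : ∀ {A : Set} {P : A → Set} (P? : Decidable P) xs →
                      length (filter P? xs) ≡ count (λ x → does (P? x)) xs
length-filter≡count P? [] = refl
length-filter≡count P? (x ∷ xs) with does (P? x)
... | true = cong suc (length-filter≡count P? xs)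
... | false = length-filter≡count P? xs

seqs-length : ∀ k → All (λ v → length v ≡ k) (seqs k)
seqs-length 0 = refl ∷ []
seqs-length (suc k) = concat⁺ (extend -1ℤ ∷ extend 0ℤ ∷ extend 1ℤ ∷ [])
  where
  extend : ∀ d → All (λ v → length v ≡ suc k) (map (d ∷_) (seqs k))
  extend d = map⁺ (All.map (cong suc) (seqs-length k))

count-seqs-suc : ∀ p k → count p (seqs (suc k)) ≡ count (λ v → p (-1ℤ ∷ v)) (seqs k)
                                                 + count (λ v → p (0ℤ ∷ v)) (seqs k)
                                                 + count (λ v → p (1ℤ ∷ v)) (seqs k)
count-seqs-suc p k = begin
  count p (branch -1ℤ ++ branch 0ℤ ++ branch 1ℤ ++ [])
    ≡⟨ count-++ p (branch -1ℤ) _ ⟩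
  count p (branch -1ℤ) + count p (branch 0ℤ ++ branch 1ℤ ++ [])
    ≡⟨ cong (λ n → count p (branch -1ℤ) + n) (count-++ p (branch 0ℤ) _) ⟩
  count p (branch -1ℤ) + (count p (branch 0ℤ) + count p (branch 1ℤ ++ []))
    ≡⟨ cong (λ ys → count p (branch -1ℤ) + (count p (branch 0ℤ) + count p ys)) (++-identityʳ (branch 1ℤ)) ⟩
  count p (branch -1ℤ) + (count p (branch 0ℤ) + count p (branch 1ℤ))
    ≡⟨ sym (ℕ.+-assoc (count p (branch -1ℤ)) _ _) ⟩
  count p (branch -1ℤ) + count p (branch 0ℤ) + count p (branch 1ℤ)
    ≡⟨ cong₂ _+_ (cong₂ _+_ (count-map p (-1ℤ ∷_) (seqs k)) (count-map p (0ℤ ∷_) (seqs k)))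
                 (count-map p (1ℤ ∷_) (seqs k)) ⟩
  _ ∎
  where
  branch : ℤ → List (List ℤ)
  branch d = map (d ∷_) (seqs k)

count-seqs-cong : ∀ {p q : List ℤ → Bool} k → (∀ {v} → length v ≡ k → p v ≡ q v) →
                  count p (seqs k) ≡ count q (seqs k)
count-seqs-cong {p} k eq = count-cong p (All.map eq (seqs-length k))

F-rec-ℤ : ∀ i → + F (2 + i) ≡ + F (1 + i) ℤ.+ + F i
F-rec-ℤ i = ℤ.pos-+ (F (1 + i)) (F i)

F-double : ∀ i → + F (2 + i) ℤ.+ + F (2 + i) ≡ + F (3 + i) ℤ.+ + F i
F-double i = begin
  + F (2 + i) ℤ.+ + F (2 + i)               ≡⟨ cong (λ x → + F (2 + i) ℤ.+ x) (F-rec-ℤ i) ⟩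
  + F (2 + i) ℤ.+ (+ F (1 + i) ℤ.+ + F i)   ≡⟨ sym (ℤ.+-assoc (+ F (2 + i)) (+ F (1 + i)) (+ F i)) ⟩
  + F (2 + i) ℤ.+ + F (1 + i) ℤ.+ + F i     ≡⟨ cong (ℤ._+ + F i) (sym (F-rec-ℤ (1 + i))) ⟩
  + F (3 + i) ℤ.+ + F i                     ∎

F-≤-suc : ∀ i → F i ≤ F (suc i)
F-≤-suc 0 = z≤n
F-≤-suc (suc i) = ℕ.m≤m+n (F (suc i)) (F i)

F-mono : ∀ {i j} → i ≤ j → F i ≤ F j
F-mono i≤j = go (ℕ.≤⇒≤′ i≤j)
  where
  go : ∀ {i j} → i ≤′ j → F i ≤ F j
  go ≤′-refl = ℕ.≤-refl
  go (≤′-step {j} i≤′j) = ℕ.≤-trans (go i≤′j) (F-≤-suc j)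

i≤F[1+i] : ∀ i → i ≤ F (suc i)
i≤F[1+i] 0 = z≤n
i≤F[1+i] 1 = s≤s z≤n
i≤F[1+i] (suc (suc i)) = subst (_≤ F (3 + i)) (ℕ.+-comm (suc i) 1)
  (ℕ.+-mono-≤ (i≤F[1+i] (suc i)) (F-mono {1} {suc i} (s≤s z≤n)))

∣i∣≤j⇒0≤i+j : ∀ i {j} → ℤ.∣ i ∣ ≤ j → 0ℤ ℤ.≤ i ℤ.+ + j
∣i∣≤j⇒0≤i+j (+ i) _ = ℤ.+≤+ z≤n
∣i∣≤j⇒0≤i+j -[1+ i ] 1+i≤j = subst (0ℤ ℤ.≤_) (sym (ℤ.⊖-≥ 1+i≤j)) (ℤ.+≤+ z≤n)

≤-shift : ∀ n a c → 0ℤ ℤ.≤ n ℤ.+ c → a ℤ.≤ n ℤ.+ (a ℤ.+ c)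
≤-shift n a c 0≤n+c = ℤ.0≤i-j⇒j≤i (subst (0ℤ ℤ.≤_) (sym (cancel n a c)) 0≤n+c)
  where
  cancel : ∀ n a c → n ℤ.+ (a ℤ.+ c) - a ≡ n ℤ.+ c
  cancel = solve-∀

does-≟-shift : ∀ c y n → does (c ℤ.+ y ℤ.≟ n) ≡ does (y ℤ.≟ n - c)
does-≟-shift c y n = does-⇔ (mk⇔ (λ e → trans (sym (cancel c y)) (cong (_- c) e))
                                  (λ e → trans (cong (λ z → c ℤ.+ z) e) (restore c n)))
                            (c ℤ.+ y ℤ.≟ n) (y ℤ.≟ n - c)
  where
  cancel : ∀ c y → c ℤ.+ y - c ≡ y
  cancel = solve-∀
  restore : ∀ c n → c ℤ.+ (n - c) ≡ n
  restore = solve-∀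

B≡count : ∀ n k → B n k ≡ count (λ v → does (value v ℤ.≟ n)) (seqs k)
B≡count n k = length-filter≡count (λ v → value v ℤ.≟ n) (seqs k)

weight : List ℤ → ℕ → ℤ
weight [] k = 0ℤ
weight (d ∷ ds) k = d ℤ.* + F (suc (length ds + k)) ℤ.+ weight ds k

value-++ : ∀ ds w → value (ds ++ w) ≡ weight ds (length w) ℤ.+ value w
value-++ [] w = sym (ℤ.+-identityˡ (value w))
value-++ (d ∷ ds) w = begin
  d ℤ.* + F (suc (length (ds ++ w))) ℤ.+ value (ds ++ w)
    ≡⟨ cong₂ (λ l x → d ℤ.* + F (suc l) ℤ.+ x) (length-++ ds) (value-++ ds w) ⟩
  d ℤ.* + F (suc (length ds + length w)) ℤ.+ (weight ds (length w) ℤ.+ value w)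
    ≡⟨ sym (ℤ.+-assoc (d ℤ.* + F (suc (length ds + length w))) _ _) ⟩
  weight (d ∷ ds) (length w) ℤ.+ value w ∎

count-seqs-prefix : ∀ ds k {n x} → n - weight ds k ≡ x →
  count (λ w → does (value (ds ++ w) ℤ.≟ n)) (seqs k) ≡ B x k
count-seqs-prefix ds k {n} refl = begin
  count (λ w → does (value (ds ++ w) ℤ.≟ n)) (seqs k)
    ≡⟨ count-seqs-cong k shift ⟩
  count (λ w → does (value w ℤ.≟ n - weight ds k)) (seqs k)
    ≡⟨ sym (B≡count _ k) ⟩
  B (n - weight ds k) k ∎
  where
  shift : ∀ {w} → length w ≡ k → does (value (ds ++ w) ℤ.≟ n) ≡ does (value w ℤ.≟ n - weight ds k)
  shift {w} refl = trans (cong (λ x → does (x ℤ.≟ n)) (value-++ ds w))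
                         (does-≟-shift (weight ds k) (value w) n)

B-suc : ∀ n k → B n (suc k) ≡ B (n ℤ.+ + F (suc k)) k + B n k + B (n - + F (suc k)) k
B-suc n k = begin
  B n (suc k)
    ≡⟨ B≡count n (suc k) ⟩
  count (λ v → does (value v ℤ.≟ n)) (seqs (suc k))
    ≡⟨ count-seqs-suc _ k ⟩
  _ ≡⟨ cong₂ _+_ (cong₂ _+_ (count-seqs-prefix (-1ℤ ∷ []) k (minus n (+ F (suc k))))
                              (count-seqs-prefix (0ℤ ∷ []) k (zero n (+ F (suc k)))))
                  (count-seqs-prefix (1ℤ ∷ []) k (plus n (+ F (suc k)))) ⟩
  B (n ℤ.+ + F (suc k)) k + B n k + B (n - + F (suc k)) k ∎
  where
  minus : ∀ n a → n - (-1ℤ ℤ.* a ℤ.+ 0ℤ) ≡ n ℤ.+ a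
  minus = solve-∀
  zero : ∀ n a → n - (0ℤ ℤ.* a ℤ.+ 0ℤ) ≡ n
  zero = solve-∀
  plus : ∀ n a → n - (1ℤ ℤ.* a ℤ.+ 0ℤ) ≡ n - a
  plus = solve-∀

neg-minus : ∀ i j → - (i - j) ≡ - i ℤ.+ j
neg-minus = solve-∀

B-neg : ∀ n k → B (- n) k ≡ B n k
B-neg +0 0 = refl
B-neg +[1+ n ] 0 = refl
B-neg -[1+ n ] 0 = refl
B-neg n (suc k) = begin
  B (- n) (suc k)
    ≡⟨ B-suc (- n) k ⟩
  B (- n ℤ.+ a) k + B (- n) k + B (- n - a) k
    ≡⟨ cong₂ _+_ (cong₂ _+_ (trans (cong (λ x → B x k) (sym (neg-minus n a))) (B-neg (n - a) k))
                            (B-neg n k))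
                 (trans (cong (λ x → B x k) (sym (ℤ.neg-distrib-+ n a))) (B-neg (n ℤ.+ a) k)) ⟩
  B (n - a) k + B n k + B (n ℤ.+ a) k
    ≡⟨ xy∙z≈zy∙x (B (n - a) k) (B n k) (B (n ℤ.+ a) k) ⟩
  B (n ℤ.+ a) k + B n k + B (n - a) k
    ≡⟨ sym (B-suc n k) ⟩
  B n (suc k) ∎
  where
  a = + F (suc k)

B-negate : ∀ {x y} k → - x ≡ y → B x k ≡ B y k
B-negate {x} k refl = sym (B-neg x k)

-- k digits represent at most F 1 + ⋯ + F k = F (k + 2) - 1.
B-vanish : ∀ {x} k → + F (2 + k) ℤ.≤ x → B x k ≡ 0
B-vanish {+0} 0 (ℤ.+≤+ ())
B-vanish {+[1+ _ ]} 0 _ = refl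
B-vanish {x} (suc k) Fk+3≤x = begin
  B x (suc k)
    ≡⟨ B-suc x k ⟩
  B (x ℤ.+ a) k + B x k + B (x - a) k
    ≡⟨ cong₂ _+_ (cong₂ _+_ (B-vanish k b≤x+a) (B-vanish k b≤x)) (B-vanish k b≤x-a) ⟩
  0 ∎
  where
  a = + F (suc k)
  b = + F (2 + k)
  b+a≤x : b ℤ.+ a ℤ.≤ x
  b+a≤x = subst (ℤ._≤ x) (F-rec-ℤ (suc k)) Fk+3≤x
  b≤x : b ℤ.≤ x
  b≤x = ℤ.≤-trans (ℤ.i≤i+j b a) b+a≤x
  b≤x+a : b ℤ.≤ x ℤ.+ a
  b≤x+a = ℤ.≤-trans b≤x (ℤ.i≤i+j x a)
  b≤x-a : b ℤ.≤ x - a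
  b≤x-a = subst (ℤ._≤ x - a) (cancel b a) (ℤ.+-monoˡ-≤ (- a) b+a≤x)
    where
    cancel : ∀ b a → b ℤ.+ a - a ≡ b
    cancel = solve-∀

-- On explicit leading digits startsSpecial computes, so below specialRep n (d ∷ e ∷ w) reduces
-- either to false or to does (value (d ∷ e ∷ w) ≟ n).
specialRep : ℤ → List ℤ → Bool
specialRep n v = does (startsSpecial v Bool.≟ true) ∧ does (value v ℤ.≟ n)

f≡count : ∀ n k → f n k ≡ count (specialRep n) (seqs k)
f≡count n k = trans (length-filter≡count (λ v → value v ℤ.≟ n) (filter special? (seqs k)))
                    (count-filter _ special? (seqs k))
  where
  special? = λ v → startsSpecial v Bool.≟ true

-- The representations counted by f(n; m+4) with leading digit -1, by prefix (-1,-1), (-1,0), (-1,1,-1).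
f₋ : ℤ → ℕ → ℕ
f₋ n m = B (n ℤ.+ (+ F (4 + m) ℤ.+ + F (3 + m))) (2 + m)
       + B (n ℤ.+ + F (4 + m)) (2 + m)
       + B (n ℤ.+ (+ F (2 + m) ℤ.+ + F (2 + m))) (1 + m)

count-specialRep-minus : ∀ n m → count (λ v → specialRep n (-1ℤ ∷ v)) (seqs (3 + m)) ≡ f₋ n m
count-specialRep-minus n m = begin
  count (λ v → specialRep n (-1ℤ ∷ v)) (seqs (3 + m))
    ≡⟨ count-seqs-suc _ (2 + m) ⟩
  _ ≡⟨ cong₂ _+_ (cong₂ _+_ (count-seqs-prefix (-1ℤ ∷ -1ℤ ∷ []) (2 + m) (two-minus n a b))
                             (count-seqs-prefix (-1ℤ ∷ 0ℤ ∷ []) (2 + m) (minus-zero n a b)))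
                  alternating-count ⟩
  f₋ n m ∎
  where
  a = + F (4 + m)
  b = + F (3 + m)
  c = + F (2 + m)
  two-minus : ∀ n a b → n - (-1ℤ ℤ.* a ℤ.+ (-1ℤ ℤ.* b ℤ.+ 0ℤ)) ≡ n ℤ.+ (a ℤ.+ b)
  two-minus = solve-∀
  minus-zero : ∀ n a b → n - (-1ℤ ℤ.* a ℤ.+ (0ℤ ℤ.* b ℤ.+ 0ℤ)) ≡ n ℤ.+ a
  minus-zero = solve-∀
  -- Used at + F (4 + m), which unfolds definitionally to b ℤ.+ c.
  alternating : ∀ n b c → n - (-1ℤ ℤ.* (b ℤ.+ c) ℤ.+ (1ℤ ℤ.* b ℤ.+ (-1ℤ ℤ.* c ℤ.+ 0ℤ))) ≡ n ℤ.+ (c ℤ.+ c)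
  alternating = solve-∀
  alternating-count : count (λ w → specialRep n (-1ℤ ∷ 1ℤ ∷ w)) (seqs (2 + m)) ≡ B (n ℤ.+ (c ℤ.+ c)) (1 + m)
  alternating-count = begin
    count (λ w → specialRep n (-1ℤ ∷ 1ℤ ∷ w)) (seqs (2 + m))
      ≡⟨ count-seqs-suc _ (1 + m) ⟩
    _ ≡⟨ cong₂ _+_ (cong₂ _+_ (count-seqs-prefix (-1ℤ ∷ 1ℤ ∷ -1ℤ ∷ []) (1 + m)
                                 (alternating n b c))
                               (count-false (seqs (1 + m))))
                    (count-false (seqs (1 + m))) ⟩
    B (n ℤ.+ (c ℤ.+ c)) (1 + m) + 0 + 0
      ≡⟨ trans (ℕ.+-identityʳ _) (ℕ.+-identityʳ _) ⟩
    B (n ℤ.+ (c ℤ.+ c)) (1 + m) ∎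

count-specialRep-plus : ∀ n m → count (λ v → specialRep n (1ℤ ∷ v)) (seqs (3 + m)) ≡ f₋ (- n) m
count-specialRep-plus n m = begin
  count (λ v → specialRep n (1ℤ ∷ v)) (seqs (3 + m))
    ≡⟨ count-seqs-suc _ (2 + m) ⟩
  _ ≡⟨ cong₂ _+_ (cong₂ _+_ alternating-count
                             (trans (count-seqs-prefix (1ℤ ∷ 0ℤ ∷ []) (2 + m) refl)
                                    (B-negate (2 + m) (plus-zero n a b))))
                  (trans (count-seqs-prefix (1ℤ ∷ 1ℤ ∷ []) (2 + m) refl)
                         (B-negate (2 + m) (two-plus n a b))) ⟩
  B (- n ℤ.+ (c ℤ.+ c)) (1 + m) + B (- n ℤ.+ a) (2 + m) + B (- n ℤ.+ (a ℤ.+ b)) (2 + m)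
    ≡⟨ xy∙z≈zy∙x (B (- n ℤ.+ (c ℤ.+ c)) (1 + m)) _ _ ⟩
  f₋ (- n) m ∎
  where
  a = + F (4 + m)
  b = + F (3 + m)
  c = + F (2 + m)
  two-plus : ∀ n a b → - (n - (1ℤ ℤ.* a ℤ.+ (1ℤ ℤ.* b ℤ.+ 0ℤ))) ≡ - n ℤ.+ (a ℤ.+ b)
  two-plus = solve-∀
  plus-zero : ∀ n a b → - (n - (1ℤ ℤ.* a ℤ.+ (0ℤ ℤ.* b ℤ.+ 0ℤ))) ≡ - n ℤ.+ a
  plus-zero = solve-∀
  -- Used at + F (4 + m), which unfolds definitionally to b ℤ.+ c.
  alternating : ∀ n b c → - (n - (1ℤ ℤ.* (b ℤ.+ c) ℤ.+ (-1ℤ ℤ.* b ℤ.+ (1ℤ ℤ.* c ℤ.+ 0ℤ)))) ≡ - n ℤ.+ (c ℤ.+ c)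
  alternating = solve-∀
  alternating-count : count (λ w → specialRep n (1ℤ ∷ -1ℤ ∷ w)) (seqs (2 + m)) ≡ B (- n ℤ.+ (c ℤ.+ c)) (1 + m)
  alternating-count = begin
    count (λ w → specialRep n (1ℤ ∷ -1ℤ ∷ w)) (seqs (2 + m))
      ≡⟨ count-seqs-suc _ (1 + m) ⟩
    _ ≡⟨ cong₂ _+_ (cong₂ _+_ (count-false (seqs (1 + m))) (count-false (seqs (1 + m))))
                    (trans (count-seqs-prefix (1ℤ ∷ -1ℤ ∷ 1ℤ ∷ []) (1 + m) refl)
                           (B-negate (1 + m) (alternating n b c))) ⟩
    B (- n ℤ.+ (c ℤ.+ c)) (1 + m) ∎

f-split : ∀ n m → f n (4 + m) ≡ f₋ n m + f₋ (- n) m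
f-split n m = begin
  f n (4 + m)                                    ≡⟨ f≡count n (4 + m) ⟩
  count (specialRep n) (seqs (4 + m))            ≡⟨ count-seqs-suc (specialRep n) (3 + m) ⟩
  _ ≡⟨ cong₂ _+_ (cong₂ _+_ (count-specialRep-minus n m) (count-false (seqs (3 + m))))
                  (count-specialRep-plus n m) ⟩
  f₋ n m + 0 + f₋ (- n) m                        ≡⟨ cong (_+ f₋ (- n) m) (ℕ.+-identityʳ (f₋ n m)) ⟩
  f₋ n m + f₋ (- n) m                            ∎

B-unfold : ∀ n m →
  B (n ℤ.+ + F (4 + m)) (3 + m) ≡ f₋ n m + B (n ℤ.+ + F (2 + m)) (1 + m) + B n (1 + m)
B-unfold n m = begin
  B (n ℤ.+ a) (3 + m)
    ≡⟨ B-suc (n ℤ.+ a) (2 + m) ⟩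
  B (n ℤ.+ a ℤ.+ b) (2 + m) + B (n ℤ.+ a) (2 + m) + B (n ℤ.+ a - b) (2 + m)
    ≡⟨ cong₂ _+_ (cong (λ x → B x (2 + m) + B (n ℤ.+ a) (2 + m)) (ℤ.+-assoc n a b))
                 (trans (cong (λ x → B x (2 + m)) a-b≡c) (B-suc (n ℤ.+ c) (1 + m))) ⟩
  X₁ + X₂ + (B (n ℤ.+ c ℤ.+ c) (1 + m) + B (n ℤ.+ c) (1 + m) + B (n ℤ.+ c - c) (1 + m))
    ≡⟨ cong₂ (λ x y → X₁ + X₂ + (B x (1 + m) + B (n ℤ.+ c) (1 + m) + B y (1 + m)))
             (ℤ.+-assoc n c c) (cancel n c) ⟩
  X₁ + X₂ + (X₃ + B (n ℤ.+ c) (1 + m) + B n (1 + m))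
    ≡⟨ reassociate X₁ X₂ X₃ _ _ ⟩
  f₋ n m + B (n ℤ.+ c) (1 + m) + B n (1 + m) ∎
  where
  a = + F (4 + m)
  b = + F (3 + m)
  c = + F (2 + m)
  X₁ = B (n ℤ.+ (a ℤ.+ b)) (2 + m)
  X₂ = B (n ℤ.+ a) (2 + m)
  X₃ = B (n ℤ.+ (c ℤ.+ c)) (1 + m)
  cancel : ∀ n c → n ℤ.+ c - c ≡ n
  cancel = solve-∀
  a-b≡c : n ℤ.+ a - b ≡ n ℤ.+ c
  a-b≡c = trans (cong (λ a → n ℤ.+ a - b) (F-rec-ℤ (2 + m))) (cancel′ n b c)
    where
    cancel′ : ∀ n b c → n ℤ.+ (b ℤ.+ c) - b ≡ n ℤ.+ c
    cancel′ = solve-∀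
  reassociate : ∀ x₁ x₂ x₃ p q → x₁ + x₂ + (x₃ + p + q) ≡ x₁ + x₂ + x₃ + p + q
  reassociate = ℕ-Solver.solve-∀

B-recurrence : ∀ n m → B n (4 + m) ≡ B n (3 + m) + B n (2 + m) + B n (1 + m) + f n (4 + m)
B-recurrence n m = begin
  B n (4 + m)
    ≡⟨ B-suc n (3 + m) ⟩
  B (n ℤ.+ a) (3 + m) + B n (3 + m) + B (n - a) (3 + m)
    ≡⟨ cong₂ _+_ (cong (_+ B n (3 + m)) (B-unfold n m))
                 (trans (B-negate (3 + m) (neg-minus n a)) (B-unfold (- n) m)) ⟩
  f₋ n m + P + C + B n (3 + m) + (f₋ (- n) m + B (- n ℤ.+ c) (1 + m) + B (- n) (1 + m))
    ≡⟨ cong₂ (λ x y → f₋ n m + P + C + B n (3 + m) + (f₋ (- n) m + x + y))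
             (B-negate (1 + m) (neg-plus n c)) (B-neg n (1 + m)) ⟩
  f₋ n m + P + C + B n (3 + m) + (f₋ (- n) m + Q + C)
    ≡⟨ rearrange (f₋ n m) (f₋ (- n) m) P Q C (B n (3 + m)) ⟩
  B n (3 + m) + (P + C + Q) + C + (f₋ n m + f₋ (- n) m)
    ≡⟨ cong₂ (λ x y → B n (3 + m) + x + C + y) (sym (B-suc n (1 + m))) (sym (f-split n m)) ⟩
  B n (3 + m) + B n (2 + m) + B n (1 + m) + f n (4 + m) ∎
  where
  a = + F (4 + m)
  c = + F (2 + m)
  P = B (n ℤ.+ c) (1 + m)
  Q = B (n - c) (1 + m)
  C = B n (1 + m)
  neg-plus : ∀ n c → - (- n ℤ.+ c) ≡ n - c
  neg-plus = solve-∀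
  rearrange : ∀ x y p q c b → x + p + c + b + (y + q + c) ≡ b + (p + c + q) + c + (x + y)
  rearrange = ℕ-Solver.solve-∀

eventually-constant : ∀ (a : ℕ → ℕ) {K} → (∀ k → K ≤ k → a (suc k) ≡ a k) →
                      ∀ k → K ≤ k → a k ≡ a K
eventually-constant a {K} step k K≤k = go (ℕ.≤⇒≤′ K≤k)
  where
  go : ∀ {k} → K ≤′ k → a k ≡ a K
  go ≤′-refl = refl
  go (≤′-step {k} K≤′k) = trans (step k (ℕ.≤′⇒≤ K≤′k)) (go K≤′k)

f₋-stable : ∀ n m → ℤ.∣ n ∣ ≤ F m → f₋ n (suc m) ≡ f₋ n m
f₋-stable n m ∣n∣≤Fm = begin
  f₋ n (suc m)                  ≡⟨ cong₂ _+_ (cong₂ _+_ X₁′≡0 X₂′≡X₂) X₃′≡0 ⟩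
  0 + B (n ℤ.+ F₄) (2 + m) + 0  ≡⟨ cong₂ _+_ (cong (_+ B (n ℤ.+ F₄) (2 + m)) (sym X₁≡0)) (sym X₃≡0) ⟩
  f₋ n m                        ∎
  where
  F₅ = + F (5 + m)
  F₄ = + F (4 + m)
  F₃ = + F (3 + m)
  F₂ = + F (2 + m)
  0≤n+F : ∀ t → 0ℤ ℤ.≤ n ℤ.+ + F (t + m)
  0≤n+F t = ∣i∣≤j⇒0≤i+j n (ℕ.≤-trans ∣n∣≤Fm (F-mono (ℕ.m≤n+m m t)))
  X₁≡0 : B (n ℤ.+ (F₄ ℤ.+ F₃)) (2 + m) ≡ 0
  X₁≡0 = B-vanish (2 + m) (≤-shift n F₄ F₃ (0≤n+F 3))
  X₁′≡0 : B (n ℤ.+ (F₅ ℤ.+ F₄)) (3 + m) ≡ 0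
  X₁′≡0 = B-vanish (3 + m) (≤-shift n F₅ F₄ (0≤n+F 4))
  X₃≡0 : B (n ℤ.+ (F₂ ℤ.+ F₂)) (1 + m) ≡ 0
  X₃≡0 = B-vanish (1 + m) (subst (λ x → F₃ ℤ.≤ n ℤ.+ x) (sym (F-double m))
                                 (≤-shift n F₃ (+ F m) (0≤n+F 0)))
  X₃′≡0 : B (n ℤ.+ (F₃ ℤ.+ F₃)) (2 + m) ≡ 0
  X₃′≡0 = B-vanish (2 + m) (subst (λ x → F₄ ℤ.≤ n ℤ.+ x) (sym (F-double (1 + m)))
                                  (≤-shift n F₄ (+ F (1 + m)) (0≤n+F 1)))
  n+F₅≡n+[F₄+F₃] : n ℤ.+ F₅ ≡ n ℤ.+ (F₄ ℤ.+ F₃)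
  n+F₅≡n+[F₄+F₃] = cong (λ x → n ℤ.+ x) (F-rec-ℤ (3 + m))
  X₂′≡X₂ : B (n ℤ.+ F₅) (3 + m) ≡ B (n ℤ.+ F₄) (2 + m)
  X₂′≡X₂ = begin
    B (n ℤ.+ F₅) (3 + m)
      ≡⟨ B-suc (n ℤ.+ F₅) (2 + m) ⟩
    B (n ℤ.+ F₅ ℤ.+ F₃) (2 + m) + B (n ℤ.+ F₅) (2 + m) + B (n ℤ.+ F₅ - F₃) (2 + m)
      ≡⟨ cong₂ _+_ (cong₂ _+_ (B-vanish (2 + m) F₄≤n+F₅+F₃)
                              (trans (cong (λ x → B x (2 + m)) n+F₅≡n+[F₄+F₃]) X₁≡0))
                   (cong (λ x → B x (2 + m)) (trans (cong (_- F₃) n+F₅≡n+[F₄+F₃]) (cancel n F₄ F₃))) ⟩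
    B (n ℤ.+ F₄) (2 + m) ∎
    where
    F₄≤n+F₅+F₃ : F₄ ℤ.≤ n ℤ.+ F₅ ℤ.+ F₃
    F₄≤n+F₅+F₃ = ℤ.≤-trans (subst (F₄ ℤ.≤_) (sym n+F₅≡n+[F₄+F₃]) (≤-shift n F₄ F₃ (0≤n+F 3)))
                           (ℤ.i≤i+j (n ℤ.+ F₅) F₃)
    cancel : ∀ n a b → n ℤ.+ (a ℤ.+ b) - b ≡ n ℤ.+ a
    cancel = solve-∀

f-stable : ∀ n m → ℤ.∣ n ∣ ≤ F m → f n (5 + m) ≡ f n (4 + m)
f-stable n m ∣n∣≤Fm = begin
  f n (5 + m)                        ≡⟨ f-split n (1 + m) ⟩
  f₋ n (1 + m) + f₋ (- n) (1 + m)    ≡⟨ cong₂ _+_ (f₋-stable n m ∣n∣≤Fm) (f₋-stable (- n) m ∣-n∣≤Fm) ⟩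
  f₋ n m + f₋ (- n) m                ≡⟨ sym (f-split n m) ⟩
  f n (4 + m)                        ∎
  where
  ∣-n∣≤Fm : ℤ.∣ - n ∣ ≤ F m
  ∣-n∣≤Fm = subst (_≤ F m) (sym (ℤ.∣-i∣≡∣i∣ n)) ∣n∣≤Fm

f-eventually-constant : ∀ n k → 5 + ℤ.∣ n ∣ ≤ k → f n k ≡ f n (5 + ℤ.∣ n ∣)
f-eventually-constant n = eventually-constant (f n) step
  where
  step : ∀ k → 5 + ℤ.∣ n ∣ ≤ k → f n (suc k) ≡ f n k
  step (suc (suc (suc (suc m)))) (s≤s (s≤s (s≤s (s≤s 1+∣n∣≤m)))) =
    f-stable n m (ℕ.≤-trans (i≤F[1+i] ℤ.∣ n ∣) (F-mono 1+∣n∣≤m))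

theorem1p2 : ((n : ℤ) (k : ℕ) → 3 ≤ k →
    B n (suc k) ≡ B n k + B n (k ∸ 1) + B n (k ∸ 2) + f n (suc k))
    × ∃ λ (g : ℤ → ℕ) → (n : ℤ) → ∃ λ (K : ℕ) → (k : ℕ) → K ≤ k → f n k ≡ g n
theorem1p2 = recurrence , (λ n → f n (5 + ℤ.∣ n ∣)) , λ n → 5 + ℤ.∣ n ∣ , f-eventually-constant n
  where
  recurrence : ∀ n k → 3 ≤ k → B n (suc k) ≡ B n k + B n (k ∸ 1) + B n (k ∸ 2) + f n (suc k)
  recurrence n _ (s≤s (s≤s (s≤s {n = m} _))) = B-recurrence n m
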